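{- Let $q$ and $x$ be indeterminates and $c\ge1$ an integer. Let $D$ be the $q$-differentiation operator on polynomials in $x$, $Df(x)=\frac{f(x)-f(qx)}{(1-q)x}$, and define the polynomials $\psi_n(x,c)=(x^c+xD)^n\,1$, where $x^c$ acts as multiplication. Let $[m]=\frac{1-q^m}{1-q}$ and, for the base $q^c$, $[m]_c=\frac{1-q^{cm}}{1-q^c}$ and $[j]_c!=[1]_c[2]_c\cdots[j]_c$ (with $[0]_c!=1$). Then for every $n\ge1$, $$\det\left(\psi_{i+j}(x,c)\right)_{i,j=0}^{n-1}=[c]^{\binom{n}{2}}x^{c\binom{n}{2}}q^{c\binom{n}{3}}\prod_{j=0}^{n-1}[j]_c!.$$ -}

module Defs where

open import Level using (Level)
open import Algebra.Bundles using (CommutativeRing)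
open import Data.Nat using (ℕ; zero; suc)
open import Data.Fin using (Fin; toℕ; punchIn) renaming (zero to fzero; suc to fsuc)
open import Data.List using (List; []; _∷_; replicate; _++_)

-- Since ℤ[q,x] is the free commutative ring on q, x, an identity holding for all
-- commutative rings and all q x is exactly the polynomial identity in ℤ[q,x].
module _ {a ℓ : Level} (R : CommutativeRing a ℓ) where
  open CommutativeRing R renaming (Carrier to A)

  pow : A → ℕ → A
  pow b zero = 1#
  pow b (suc n) = b * pow b n

  -- q-integer in base b:  [m]_b = (1 - b^m)/(1 - b) = 1 + b + ... + b^(m-1)
  qint : A → ℕ → A
  qint b zero = 0#
  qint b (suc m) = 1# + b * qint b m

  qfact : A → ℕ → A
  qfact b zero = 1#
  qfact b (suc j) = qfact b j * qint b (suc j)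

  prodUpTo : (ℕ → A) → ℕ → A
  prodUpTo f zero = 1#
  prodUpTo f (suc n) = prodUpTo f n * f n

  -- Polynomials in x over R: coefficient lists, lowest degree first.
  Poly : Set a
  Poly = List A

  _⊕_ : Poly → Poly → Poly
  [] ⊕ p = p
  (u ∷ us) ⊕ [] = u ∷ us
  (u ∷ us) ⊕ (v ∷ vs) = (u + v) ∷ (us ⊕ vs)

  mulXPow : ℕ → Poly → Poly
  mulXPow k p = replicate k 0# ++ p

  -- q-derivative: D x^k = [k]_q x^(k-1)  (i.e. (x^k - (qx)^k)/((1-q)x)), D 1 = 0
  DFrom : A → ℕ → Poly → Poly
  DFrom q k [] = []
  DFrom q k (u ∷ us) = (u * qint q k) ∷ DFrom q (suc k) us

  D : A → Poly → Poly
  D q [] = []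
  D q (u ∷ us) = DFrom q 1 us

  T : A → ℕ → Poly → Poly
  T q c p = mulXPow c p ⊕ mulXPow 1 (D q p)

  ψ : A → ℕ → ℕ → Poly
  ψ q c zero = 1# ∷ []
  ψ q c (suc n) = T q c (ψ q c n)

  eval : A → Poly → A
  eval x [] = 0#
  eval x (u ∷ us) = u + x * eval x us

  sumFin : (n : ℕ) → (Fin n → A) → A
  sumFin zero f = 0#
  sumFin (suc n) f = f fzero + sumFin n (λ j → f (fsuc j))

  det : (n : ℕ) → (Fin n → Fin n → A) → A
  det zero M = 1#
  det (suc n) M =
    sumFin (suc n) (λ j → pow (- 1#) (toℕ j) * (M fzero j * det n (λ i k → M (fsuc i) (punchIn j k))))

-- Write X for the variable of the polynomials, y = x^c and p = q^c.  The polynomials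
-- P_m = (X^c − y)(X^c − y p)⋯(X^c − y p^(m−1)) satisfy the three-term recurrence
-- T P_m = P_(m+1) + b_m P_m + λ_(m−1) P_(m−1) with b_m = y p^m + [c][m]_p and
-- λ_m = [c][m+1]_p y p^m, while P_m(x) = 0 for m ≥ 1.  Hence ψ_n(x,c) = (T^n P_0)(x)
-- is a weighted count of Motzkin paths of length n from height 0 back to 0.  A Hankel
-- matrix of such path counts factors as L·U with L unit lower triangular (paths from
-- height 0 to height k) and U upper triangular with diagonal λ_0⋯λ_(j−1) (paths from
-- height k down to 0), so its determinant is ∏_(j<n) λ_0⋯λ_(j−1), the stated product.
module Submission where

open import Level using (Level; 0ℓ)
open import Algebra.Bundles using (CommutativeRing)
open import Data.Nat.Base as ℕ using (ℕ; zero; suc; z≤n; s≤s)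
import Data.Nat.Properties as ℕ
open import Data.Nat.Combinatorics using (_C_; nCk+nC[k+1]≡[n+1]C[k+1]; nC1≡n)
open import Data.Fin.Base using (Fin; toℕ; punchIn; lift) renaming (zero to fzero; suc to fsuc)
open import Data.Fin.Properties using (toℕ<n)
open import Function.Base using (const; _∘_)
open import Relation.Binary.PropositionalEquality.Core as ≡ using (_≡_)

[1+n]C2≡n+nC2 : ∀ n → suc n C 2 ≡ n ℕ.+ n C 2
[1+n]C2≡n+nC2 n = ≡.trans (≡.sym (nCk+nC[k+1]≡[n+1]C[k+1] n 1)) (≡.cong (ℕ._+ n C 2) (nC1≡n n))

[1+n]C3≡nC2+nC3 : ∀ n → suc n C 3 ≡ n C 2 ℕ.+ n C 3
[1+n]C3≡nC2+nC3 n = ≡.sym (nCk+nC[k+1]≡[n+1]C[k+1] n 2)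

-- Ring normalisation with integer coefficients, read in R through ℤ → R.  (The library's
-- reflective solver takes the carrier of R as coefficients and so cannot cancel a − a.)
module IntegerRingSolver {a ℓ : Level} (R : CommutativeRing a ℓ) where
  open import Data.Bool.Base using (Bool; true; false) renaming (T to True)
  open import Data.Maybe.Base using (nothing)
  open import Data.Integer.Base as ℤ using (ℤ; +_; -[1+_]; _⊖_; sign; ∣_∣)
  import Data.Integer.Properties as ℤ
  open import Data.Sign.Base as Sign using (Sign)
  open import Data.Product.Base using (_×_; _,_; proj₁; proj₂)
  open import Data.Vec.Base using (Vec)
  open import Data.Vec.N-ary using (N-ary; Eq; Eqʰ; curryⁿ)
  open import Tactic.RingSolver.Core.AlmostCommutativeRing using (fromCommutativeRing)
  open import Tactic.RingSolver.Core.Polynomial.Parameters using (Homomorphism)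
  open CommutativeRing R renaming (Carrier to A)
  open import Algebra.Properties.Ring ring using (-‿involutive; -0#≈0#; -‿+-comm; -1*x≈-x)
  open import Algebra.Properties.AbelianGroup +-abelianGroup using (xyx⁻¹≈y)
  open import Algebra.Properties.CommutativeSemigroup *-commutativeSemigroup using (interchange)
  open import Algebra.Properties.Semiring.Mult.TCOptimised semiring
    using (×-homo-+; ×1-homo-*; 1+×) renaming (_×_ to _×ᴿ_)
  open import Algebra.Properties.Semiring.Exp.TCOptimised semiring using (^-congˡ)
  open import Relation.Binary.Reasoning.Setoid setoid

  ℕ⟦_⟧ : ℕ → A
  ℕ⟦ n ⟧ = n ×ᴿ 1#

  ⟦_⟧ℤ : ℤ → A
  ⟦ + n ⟧ℤ = ℕ⟦ n ⟧
  ⟦ -[1+ n ] ⟧ℤ = - ℕ⟦ suc n ⟧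

  private
    ⊖-homo : ∀ m n → ⟦ m ⊖ n ⟧ℤ ≈ ℕ⟦ m ⟧ - ℕ⟦ n ⟧
    ⊖-homo m zero = sym (trans (+-congˡ -0#≈0#) (+-identityʳ _))
    ⊖-homo zero (suc n) = sym (+-identityˡ _)
    ⊖-homo (suc m) (suc n) = begin
      ⟦ suc m ⊖ suc n ⟧ℤ              ≡⟨ ≡.cong ⟦_⟧ℤ (ℤ.[1+m]⊖[1+n]≡m⊖n m n) ⟩
      ⟦ m ⊖ n ⟧ℤ                      ≈⟨ ⊖-homo m n ⟩
      ℕ⟦ m ⟧ - ℕ⟦ n ⟧                 ≈⟨ sym (xyx⁻¹≈y 1# (ℕ⟦ m ⟧ - ℕ⟦ n ⟧)) ⟩
      1# + (ℕ⟦ m ⟧ - ℕ⟦ n ⟧) - 1#     ≈⟨ +-assoc _ _ _ ⟩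
      1# + ((ℕ⟦ m ⟧ - ℕ⟦ n ⟧) - 1#)   ≈⟨ +-congˡ (+-assoc _ _ _) ⟩
      1# + (ℕ⟦ m ⟧ + (- ℕ⟦ n ⟧ - 1#)) ≈⟨ sym (+-assoc _ _ _) ⟩
      (1# + ℕ⟦ m ⟧) + (- ℕ⟦ n ⟧ - 1#) ≈⟨ +-congˡ (trans (+-comm _ _) (-‿+-comm 1# ℕ⟦ n ⟧)) ⟩
      (1# + ℕ⟦ m ⟧) - (1# + ℕ⟦ n ⟧)   ≈⟨ sym (+-cong (1+× m 1#) (-‿cong (1+× n 1#))) ⟩
      ℕ⟦ suc m ⟧ - ℕ⟦ suc n ⟧         ∎

    sign⟦_⟧ : Sign → A
    sign⟦ Sign.+ ⟧ = 1#
    sign⟦ Sign.- ⟧ = - 1#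

    ◃-homo : ∀ s n → ⟦ s ℤ.◃ n ⟧ℤ ≈ sign⟦ s ⟧ * ℕ⟦ n ⟧
    ◃-homo s zero = sym (zeroʳ _)
    ◃-homo Sign.+ (suc n) = sym (*-identityˡ _)
    ◃-homo Sign.- (suc n) = sym (-1*x≈-x _)

    sign-homo : ∀ s t → sign⟦ s Sign.* t ⟧ ≈ sign⟦ s ⟧ * sign⟦ t ⟧
    sign-homo Sign.+ t = sym (*-identityˡ _)
    sign-homo Sign.- Sign.+ = sym (*-identityʳ _)
    sign-homo Sign.- Sign.- = sym (trans (-1*x≈-x _) (-‿involutive 1#))

    sign-abs : ∀ i → ⟦ i ⟧ℤ ≈ sign⟦ sign i ⟧ * ℕ⟦ ∣ i ∣ ⟧
    sign-abs i = trans (reflexive (≡.cong ⟦_⟧ℤ (≡.sym (ℤ.◃-inverse i)))) (◃-homo (sign i) ∣ i ∣)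

    +-homo : ∀ i j → ⟦ i ℤ.+ j ⟧ℤ ≈ ⟦ i ⟧ℤ + ⟦ j ⟧ℤ
    +-homo (+ m) (+ n) = ×-homo-+ 1# m n
    +-homo (+ m) -[1+ n ] = ⊖-homo m (suc n)
    +-homo -[1+ m ] (+ n) = trans (⊖-homo n (suc m)) (+-comm _ _)
    +-homo -[1+ m ] -[1+ n ] = begin
      - ℕ⟦ suc (suc (m ℕ.+ n)) ⟧    ≡⟨ ≡.cong (λ k → - ℕ⟦ suc k ⟧) (≡.sym (ℕ.+-suc m n)) ⟩
      - ℕ⟦ suc m ℕ.+ suc n ⟧        ≈⟨ -‿cong (×-homo-+ 1# (suc m) (suc n)) ⟩
      - (ℕ⟦ suc m ⟧ + ℕ⟦ suc n ⟧)   ≈⟨ sym (-‿+-comm _ _) ⟩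
      - ℕ⟦ suc m ⟧ + - ℕ⟦ suc n ⟧   ∎

    *-homo : ∀ i j → ⟦ i ℤ.* j ⟧ℤ ≈ ⟦ i ⟧ℤ * ⟦ j ⟧ℤ
    *-homo i j = begin
      ⟦ i ℤ.* j ⟧ℤ
        ≈⟨ ◃-homo (sign i Sign.* sign j) (∣ i ∣ ℕ.* ∣ j ∣) ⟩
      sign⟦ sign i Sign.* sign j ⟧ * ℕ⟦ ∣ i ∣ ℕ.* ∣ j ∣ ⟧
        ≈⟨ *-cong (sign-homo (sign i) (sign j)) (×1-homo-* ∣ i ∣ ∣ j ∣) ⟩
      (sign⟦ sign i ⟧ * sign⟦ sign j ⟧) * (ℕ⟦ ∣ i ∣ ⟧ * ℕ⟦ ∣ j ∣ ⟧)
        ≈⟨ interchange _ _ _ _ ⟩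
      (sign⟦ sign i ⟧ * ℕ⟦ ∣ i ∣ ⟧) * (sign⟦ sign j ⟧ * ℕ⟦ ∣ j ∣ ⟧)
        ≈⟨ sym (*-cong (sign-abs i) (sign-abs j)) ⟩
      ⟦ i ⟧ℤ * ⟦ j ⟧ℤ ∎

    -‿homo : ∀ i → ⟦ ℤ.- i ⟧ℤ ≈ - ⟦ i ⟧ℤ
    -‿homo (+ zero) = sym -0#≈0#
    -‿homo (+ suc n) = refl
    -‿homo -[1+ n ] = sym (-‿involutive _)

    isZero : ℤ → Bool
    isZero (+ zero) = true
    isZero _ = false

    isZero-sound : ∀ i → True (isZero i) → 0# ≈ ⟦ i ⟧ℤ
    isZero-sound (+ zero) _ = refl

    homomorphism : Homomorphism 0ℓ 0ℓ a ℓ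
    homomorphism = record
      { from = record { rawRing = ℤ.+-*-rawRing ; isZero = isZero }
      ; to = fromCommutativeRing R (λ _ → nothing)
      ; morphism = record
        { ⟦_⟧ = ⟦_⟧ℤ ; +-homo = +-homo ; *-homo = *-homo ; -‿homo = -‿homo
        ; 0-homo = refl ; 1-homo = refl }
      ; Zero-C⟶Zero-R = isZero-sound
      }

  open import Tactic.RingSolver.Core.Expression using (Expr; Κ; Ι)
  open import Tactic.RingSolver.Core.Expression public
    using () renaming (_⊕_ to infixl 6 _:+_; _⊗_ to infixl 7 _:*_; ⊝_ to infix 8 :-_)

  module Ops where
    open import Tactic.RingSolver.Core.Expression using (module Eval; _⊕_; _⊗_; ⊝_; _⊛_)
    open Eval (Homomorphism.rawRing homomorphism) ⟦_⟧ℤ public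
    open import Tactic.RingSolver.Core.Polynomial.Base (Homomorphism.from homomorphism)
    open import Tactic.RingSolver.Core.Polynomial.Semantics homomorphism using () renaming (⟦_⟧ to ⟦_⟧ₚ)
    open import Tactic.RingSolver.Core.Polynomial.Homomorphism homomorphism

    norm : ∀ {n} → Expr ℤ n → Poly n
    norm (Κ x)   = κ x
    norm (Ι x)   = ι x
    norm (x ⊕ y) = norm x ⊞ norm y
    norm (x ⊗ y) = norm x ⊠ norm y
    norm (⊝ x)   = ⊟ norm x
    norm (x ⊛ i) = norm x ⊡ i

    ⟦_⇓⟧ : ∀ {n} → Expr ℤ n → Vec A n → A
    ⟦ expr ⇓⟧ = ⟦ norm expr ⟧ₚ

    correct : ∀ {n} (expr : Expr ℤ n) ρ → ⟦ expr ⇓⟧ ρ ≈ ⟦ expr ⟧ ρ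
    correct (Κ x)   ρ = κ-hom x ρ
    correct (Ι x)   ρ = ι-hom x ρ
    correct (x ⊕ y) ρ = trans (⊞-hom (norm x) (norm y) ρ) (+-cong (correct x ρ) (correct y ρ))
    correct (x ⊗ y) ρ = trans (⊠-hom (norm x) (norm y) ρ) (*-cong (correct x ρ) (correct y ρ))
    correct (⊝ x)   ρ = trans (⊟-hom (norm x) ρ) (-‿cong (correct x ρ))
    correct (x ⊛ i) ρ = trans (⊡-hom (norm x) i ρ) (^-congˡ i (correct x ρ))

    open import Relation.Binary.Reflection setoid Ι ⟦_⟧ ⟦_⇓⟧ correct public

  :0 :1 : ∀ {n} → Expr ℤ n
  :0 = Κ (+ 0)
  :1 = Κ (+ 1)

  solve : ∀ (n : ℕ) →
          (f : N-ary n (Expr ℤ n) (Expr ℤ n × Expr ℤ n)) →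
          Eqʰ n _≈_ (curryⁿ (Ops.⟦_⇓⟧ (proj₁ (Ops.close n f)))) (curryⁿ (Ops.⟦_⇓⟧ (proj₂ (Ops.close n f)))) →
          Eq  n _≈_ (curryⁿ (Ops.⟦_⟧  (proj₁ (Ops.close n f)))) (curryⁿ (Ops.⟦_⟧  (proj₂ (Ops.close n f))))
  solve = Ops.solve

  infix 4 _⊜_
  _⊜_ : ∀ {n : ℕ} → Expr ℤ n → Expr ℤ n → Expr ℤ n × Expr ℤ n
  _⊜_ = _,_

open import Defs

module QArithmetic {a ℓ : Level} (R : CommutativeRing a ℓ) where
  open CommutativeRing R renaming (Carrier to A)
  open IntegerRingSolver R
  open import Relation.Binary.Reasoning.Setoid setoid
  open import Algebra.Properties.Semiring.Exp semiring using (_^_; ^-homo-*; ^-assocʳ)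

  pow≡^ : ∀ b n → pow R b n ≡ b ^ n
  pow≡^ b zero = ≡.refl
  pow≡^ b (suc n) = ≡.cong (b *_) (pow≡^ b n)

  pow-+ : ∀ b m n → pow R b (m ℕ.+ n) ≈ pow R b m * pow R b n
  pow-+ b m n rewrite pow≡^ b (m ℕ.+ n) | pow≡^ b m | pow≡^ b n = ^-homo-* b m n

  pow-* : ∀ b m n → pow R b (m ℕ.* n) ≈ pow R (pow R b m) n
  pow-* b m n rewrite pow≡^ b (m ℕ.* n) | pow≡^ (pow R b m) n | pow≡^ b m = sym (^-assocʳ b m n)

  pow-pow-+ : ∀ b c k j → pow R (pow R b c) k * pow R b (c ℕ.* j) ≈ pow R b (c ℕ.* (k ℕ.+ j))
  pow-pow-+ b c k j = begin
    pow R (pow R b c) k * pow R b (c ℕ.* j)  ≈⟨ *-congʳ (sym (pow-* b c k)) ⟩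
    pow R b (c ℕ.* k) * pow R b (c ℕ.* j)    ≈⟨ sym (pow-+ b (c ℕ.* k) (c ℕ.* j)) ⟩
    pow R b (c ℕ.* k ℕ.+ c ℕ.* j)            ≡⟨ ≡.cong (pow R b) (≡.sym (ℕ.*-distribˡ-+ c k j)) ⟩
    pow R b (c ℕ.* (k ℕ.+ j))                ∎

  qint-+ : ∀ b m k → qint R b (m ℕ.+ k) ≈ qint R b m + pow R b m * qint R b k
  qint-+ b zero k = sym (trans (+-identityˡ _) (*-identityˡ _))
  qint-+ b (suc m) k = trans (+-congˡ (*-congˡ (qint-+ b m k)))
    (solve 4 (λ b a P Q → :1 :+ b :* (a :+ P :* Q) ⊜ (:1 :+ b :* a) :+ (b :* P) :* Q) refl _ _ _ _)

  prodUpTo-head : ∀ n (d : ℕ → A) → prodUpTo R d (suc n) ≈ d 0 * prodUpTo R (d ∘ suc) n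
  prodUpTo-head zero d = trans (*-identityˡ _) (sym (*-identityʳ _))
  prodUpTo-head (suc n) d = trans (*-congʳ (prodUpTo-head n d)) (*-assoc _ _ _)

module Determinant {a ℓ : Level} (R : CommutativeRing a ℓ) where
  open import Data.Vec.Functional using (_∷_; tail; updateAt)
  open import Data.Vec.Functional.Properties using (updateAt-updates)
  open CommutativeRing R renaming (Carrier to A)
  open IntegerRingSolver R
  open QArithmetic R using (prodUpTo-head)
  import Algebra.Properties.Semiring.Sum semiring as Sum
  open import Relation.Binary.Reasoning.Setoid setoid

  ∑ : (n : ℕ) → (Fin n → A) → A
  ∑ = sumFin R

  private
    ∑≈sum : ∀ n (f : Fin n → A) → ∑ n f ≈ Sum.sum f
    ∑≈sum zero f = refl
    ∑≈sum (suc n) f = +-congˡ (∑≈sum n (tail f))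

  ∑-cong : ∀ n {f g : Fin n → A} → (∀ i → f i ≈ g i) → ∑ n f ≈ ∑ n g
  ∑-cong n {f} {g} f≈g = trans (∑≈sum n f) (trans (Sum.sum-cong-≋ f≈g) (sym (∑≈sum n g)))

  ∑-zero : ∀ n {f : Fin n → A} → (∀ i → f i ≈ 0#) → ∑ n f ≈ 0#
  ∑-zero n {f} f≈0 = trans (∑≈sum n f) (trans (Sum.sum-cong-≋ f≈0) (Sum.sum-replicate-zero n))

  ∑-distrib-+ : ∀ n (f g : Fin n → A) → ∑ n (λ i → f i + g i) ≈ ∑ n f + ∑ n g
  ∑-distrib-+ n f g = trans (∑≈sum n _) (trans (Sum.∑-distrib-+ f g) (sym (+-cong (∑≈sum n f) (∑≈sum n g))))

  *-distribˡ-∑ : ∀ n x (f : Fin n → A) → x * ∑ n f ≈ ∑ n (λ i → x * f i)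
  *-distribˡ-∑ n x f = trans (*-congˡ (∑≈sum n f)) (trans (Sum.*-distribˡ-sum x f) (sym (∑≈sum n _)))

  ∑-comm : ∀ m n (f : Fin m → Fin n → A) → ∑ m (λ i → ∑ n (f i)) ≈ ∑ n (λ j → ∑ m (λ i → f i j))
  ∑-comm m n f = begin
    ∑ m (λ i → ∑ n (f i))                  ≈⟨ trans (∑-cong m (λ i → ∑≈sum n (f i))) (∑≈sum m _) ⟩
    Sum.sum (λ i → Sum.sum (f i))          ≈⟨ Sum.∑-comm f ⟩
    Sum.sum (λ j → Sum.sum (λ i → f i j))  ≈⟨ sym (trans (∑-cong n (λ j → ∑≈sum m _)) (∑≈sum n _)) ⟩
    ∑ n (λ j → ∑ m (λ i → f i j))          ∎

  Matrix : ℕ → ℕ → Set a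
  Matrix m n = Fin m → Fin n → A

  sgn : ∀ {n} → Fin n → A
  sgn j = pow R (- 1#) (toℕ j)

  minor : ∀ {m n} → Matrix (suc m) (suc n) → Fin (suc n) → Matrix m n
  minor M j i k = M (fsuc i) (punchIn j k)

  -- Laplace expansion along a row u, D k being the minor complementary to u k.
  expandRow : ∀ {n} → (Fin n → A) → (Fin n → A) → A
  expandRow {n} u D = ∑ n (λ k → sgn k * (u k * D k))

  expandRow-cong : ∀ {n} (u : Fin n → A) {D E : Fin n → A} → (∀ k → D k ≈ E k) →
    expandRow u D ≈ expandRow u E
  expandRow-cong {n} u D≈E = ∑-cong n (λ k → *-congˡ (*-congˡ (D≈E k)))

  expandRow-zero : ∀ {n} (u : Fin n → A) {D : Fin n → A} → (∀ k → D k ≈ 0#) → expandRow u D ≈ 0#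
  expandRow-zero {n} u D≈0 = ∑-zero n (λ k → trans (*-congˡ (trans (*-congˡ (D≈0 k)) (zeroʳ _))) (zeroʳ _))

  expandRow-linear : ∀ {n} (u w : Fin n → A) α (D : Fin n → A) →
    expandRow (λ k → u k + α * w k) D ≈ expandRow u D + α * expandRow w D
  expandRow-linear {n} u w α D = begin
    expandRow (λ k → u k + α * w k) D
      ≈⟨ ∑-cong n (λ k → solve 5 (λ s u α w d → s :* ((u :+ α :* w) :* d) ⊜ s :* (u :* d) :+ α :* (s :* (w :* d)))
                                  refl (sgn k) (u k) α (w k) (D k)) ⟩
    ∑ n (λ k → sgn k * (u k * D k) + α * (sgn k * (w k * D k)))
      ≈⟨ trans (∑-distrib-+ n _ _) (+-congˡ (sym (*-distribˡ-∑ n α _))) ⟩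
    expandRow u D + α * expandRow w D ∎

  expandRow-+∑ : ∀ {n m} (u D : Fin n → A) (c : Fin m → A) (E : Fin m → Fin n → A) →
    expandRow u (λ k → D k + ∑ m (λ i → c i * E i k)) ≈ expandRow u D + ∑ m (λ i → c i * expandRow u (E i))
  expandRow-+∑ {n} {m} u D c E = begin
    expandRow u (λ k → D k + ∑ m (λ i → c i * E i k))
      ≈⟨ ∑-cong n (λ k → trans (solve 4 (λ s u d e → s :* (u :* (d :+ e)) ⊜ s :* (u :* d) :+ (s :* u) :* e)
                                         refl _ _ _ _)
                               (+-congˡ (*-distribˡ-∑ m (sgn k * u k) _))) ⟩
    ∑ n (λ k → sgn k * (u k * D k) + ∑ m (λ i → (sgn k * u k) * (c i * E i k)))
      ≈⟨ trans (∑-distrib-+ n _ _) (+-congˡ (∑-comm n m _)) ⟩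
    expandRow u D + ∑ m (λ i → ∑ n (λ k → (sgn k * u k) * (c i * E i k)))
      ≈⟨ +-congˡ (∑-cong m (λ i → trans
           (∑-cong n (λ k → solve 4 (λ s u c e → (s :* u) :* (c :* e) ⊜ c :* (s :* (u :* e))) refl _ _ _ _))
           (sym (*-distribˡ-∑ n (c i) _)))) ⟩
    expandRow u D + ∑ m (λ i → c i * expandRow u (E i)) ∎

  det-cong : ∀ n {M N : Matrix n n} → (∀ i j → M i j ≈ N i j) → det R n M ≈ det R n N
  det-cong zero M≈N = refl
  det-cong (suc n) M≈N =
    ∑-cong (suc n) (λ k → *-congˡ {sgn k} (*-cong (M≈N fzero k)
                                                  (det-cong n (λ i l → M≈N (fsuc i) (punchIn k l)))))

  Extensional : ∀ {m n} → ((Fin m → Fin n) → A) → Set ℓ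
  Extensional X = ∀ {f g} → (∀ l → f l ≡ g l) → X f ≈ X g

  -- X assigns to a choice of columns the minor of the remaining rows on them.
  expandTwoRows : ∀ m → (v w : Fin (suc (suc m)) → A) → ((Fin m → Fin (suc (suc m))) → A) → A
  expandTwoRows m v w X = expandRow v (λ j → expandRow (w ∘ punchIn j) (λ k → X (punchIn j ∘ punchIn k)))

  expandTwoRows-cong : ∀ m v w {X Y : (Fin m → Fin (suc (suc m))) → A} → (∀ f → X f ≈ Y f) →
    expandTwoRows m v w X ≈ expandTwoRows m v w Y
  expandTwoRows-cong m v w X≈Y =
    expandRow-cong v (λ j → expandRow-cong (w ∘ punchIn j) (λ k → X≈Y (punchIn j ∘ punchIn k)))

  expandTwoRows-zero : ∀ v w X → Extensional X →
    expandTwoRows 0 v w X ≈ (v fzero * w (fsuc fzero) - v (fsuc fzero) * w fzero) * X (λ ())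
  expandTwoRows-zero v w X ext = trans (expandTwoRows-cong 0 v w (λ f → ext {f} {λ ()} (λ ())))
    (solve 5 (λ v₀ v₁ w₀ w₁ x →
        :1 :* (v₀ :* (:1 :* (w₁ :* x) :+ :0))
          :+ ((:- :1 :* :1) :* (v₁ :* (:1 :* (w₀ :* x) :+ :0)) :+ :0)
        ⊜ (v₀ :* w₁ :+ :- (v₁ :* w₀)) :* x) refl _ _ _ _ _)

  expandTail : ∀ m → (u : Fin (suc (suc (suc m))) → A) → ((Fin (suc m) → Fin (suc (suc (suc m)))) → A) → A
  expandTail m u X = expandRow (tail u) (λ k → X (fsuc ∘ punchIn k))

  expandTwoRows-suc : ∀ m v w X → Extensional X →
    expandTwoRows (suc m) v w X
      ≈ (v fzero * expandTail m w X - w fzero * expandTail m v X) + expandTwoRows m (tail v) (tail w) (X ∘ lift 1)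
  expandTwoRows-suc m v w X ext = begin
    expandTwoRows (suc m) v w X
      ≈⟨ +-congˡ (∑-cong (suc (suc m)) term) ⟩
    1# * (v fzero * expandTail m w X) + ∑ (suc (suc m)) (λ j → (- 1# * w fzero) * tailTerm j + restTerm j)
      ≈⟨ +-congˡ (trans (∑-distrib-+ (suc (suc m)) (λ j → (- 1# * w fzero) * tailTerm j) restTerm)
                        (+-congʳ (sym (*-distribˡ-∑ (suc (suc m)) (- 1# * w fzero) tailTerm)))) ⟩
    1# * (v fzero * expandTail m w X) + ((- 1# * w fzero) * expandTail m v X + expandTwoRows m (tail v) (tail w) (X ∘ lift 1))
      ≈⟨ solve 5 (λ v₀ w₀ V W E → :1 :* (v₀ :* W) :+ ((:- :1 :* w₀) :* V :+ E) ⊜ (v₀ :* W :+ :- (w₀ :* V)) :+ E)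
                 refl _ _ _ _ _ ⟩
    (v fzero * expandTail m w X - w fzero * expandTail m v X) + expandTwoRows m (tail v) (tail w) (X ∘ lift 1) ∎
    where
    rest tailTerm restTerm : Fin (suc (suc m)) → A
    rest j = expandRow (tail w ∘ punchIn j) (λ k → X (lift 1 (punchIn j ∘ punchIn k)))
    tailTerm j = sgn j * (tail v j * X (fsuc ∘ punchIn j))
    restTerm j = sgn j * (tail v j * rest j)
    inner : ∀ j → expandRow (w ∘ punchIn (fsuc j)) (λ k → X (punchIn (fsuc j) ∘ punchIn k))
                ≈ 1# * (w fzero * X (fsuc ∘ punchIn j)) + - 1# * rest j
    inner j = +-congˡ (trans (∑-cong (suc m) step) (sym (*-distribˡ-∑ (suc m) (- 1#) restᵏ)))
      where
      restᵏ : Fin (suc m) → A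
      restᵏ k = sgn k * (tail w (punchIn j k) * X (lift 1 (punchIn j ∘ punchIn k)))
      step : ∀ k → sgn (fsuc k) * (w (punchIn (fsuc j) (fsuc k)) * X (punchIn (fsuc j) ∘ punchIn (fsuc k)))
                 ≈ - 1# * restᵏ k
      step k = trans (*-assoc _ _ _) (*-congˡ (*-congˡ (*-congˡ (ext (λ { fzero → ≡.refl ; (fsuc l) → ≡.refl })))))
    term : ∀ j → sgn (fsuc j) * (tail v j * expandRow (w ∘ punchIn (fsuc j)) (λ k → X (punchIn (fsuc j) ∘ punchIn k)))
               ≈ (- 1# * w fzero) * tailTerm j + restTerm j
    term j = trans (*-congˡ (*-congˡ (inner j)))
      (solve 5 (λ s vⱼ w₀ y z → (:- :1 :* s) :* (vⱼ :* (:1 :* (w₀ :* y) :+ :- :1 :* z))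
                                ⊜ (:- :1 :* w₀) :* (s :* (vⱼ :* y)) :+ s :* (vⱼ :* z)) refl _ _ _ _ _)

  extensional-lift : ∀ {m n} {X : (Fin (suc m) → Fin (suc n)) → A} → Extensional X → Extensional (X ∘ lift 1)
  extensional-lift ext f≗g = ext (λ { fzero → ≡.refl ; (fsuc l) → ≡.cong fsuc (f≗g l) })

  expandTwoRows-alternating : ∀ m v X → Extensional X → expandTwoRows m v v X ≈ 0#
  expandTwoRows-alternating zero v X ext = trans (expandTwoRows-zero v v X ext)
    (solve 3 (λ a b x → (a :* b :+ :- (b :* a)) :* x ⊜ :0) refl _ _ _)
  expandTwoRows-alternating (suc m) v X ext = begin
    expandTwoRows (suc m) v v X
      ≈⟨ expandTwoRows-suc m v v X ext ⟩
    (v fzero * expandTail m v X - v fzero * expandTail m v X) + expandTwoRows m (tail v) (tail v) (X ∘ lift 1)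
      ≈⟨ +-cong (-‿inverseʳ _) (expandTwoRows-alternating m (tail v) (X ∘ lift 1) (extensional-lift ext)) ⟩
    0# + 0#
      ≈⟨ +-identityʳ 0# ⟩
    0# ∎

  expandTwoRows-antisymmetric : ∀ m v w X → Extensional X → expandTwoRows m v w X + expandTwoRows m w v X ≈ 0#
  expandTwoRows-antisymmetric zero v w X ext =
    trans (+-cong (expandTwoRows-zero v w X ext) (expandTwoRows-zero w v X ext))
      (solve 5 (λ v₀ v₁ w₀ w₁ x → (v₀ :* w₁ :+ :- (v₁ :* w₀)) :* x :+ (w₀ :* v₁ :+ :- (w₁ :* v₀)) :* x ⊜ :0)
               refl _ _ _ _ _)
  expandTwoRows-antisymmetric (suc m) v w X ext =
    trans (+-cong (expandTwoRows-suc m v w X ext) (expandTwoRows-suc m w v X ext))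
      (trans (solve 6 (λ v₀ w₀ V W E F → (v₀ :* W :+ :- (w₀ :* V)) :+ E :+ ((w₀ :* V :+ :- (v₀ :* W)) :+ F) ⊜ E :+ F)
                      refl _ _ _ _ _ _)
             (expandTwoRows-antisymmetric m (tail v) (tail w) (X ∘ lift 1) (extensional-lift ext)))

  lowerMinors : ∀ {n} → Matrix (suc (suc n)) (suc (suc n)) → (Fin n → Fin (suc (suc n))) → A
  lowerMinors {n} M f = det R n (λ i l → M (fsuc (fsuc i)) (f l))

  lowerMinors-extensional : ∀ {n} (M : Matrix (suc (suc n)) (suc (suc n))) → Extensional (lowerMinors M)
  lowerMinors-extensional {n} M f≗g = det-cong n (λ i l → reflexive (≡.cong (M (fsuc (fsuc i))) (f≗g l)))

  det-firstRowRepeated : ∀ n (s : Fin n) (M : Matrix (suc n) (suc n)) → (∀ k → M fzero k ≈ M (fsuc s) k) →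
    det R (suc n) M ≈ 0#
  det-firstRowRepeated (suc n) fzero M M₀≈M₁ = begin
    expandTwoRows n (M fzero) (M (fsuc fzero)) (lowerMinors M)
      ≈⟨ det-cong (suc (suc n)) {M} {M₁M₁} (λ { fzero k → M₀≈M₁ k ; (fsuc i) k → refl }) ⟩
    expandTwoRows n (M (fsuc fzero)) (M (fsuc fzero)) (lowerMinors M)
      ≈⟨ expandTwoRows-alternating n (M (fsuc fzero)) (lowerMinors M) (lowerMinors-extensional M) ⟩
    0# ∎
    where
    M₁M₁ : Matrix (suc (suc n)) (suc (suc n))
    M₁M₁ fzero = M (fsuc fzero)
    M₁M₁ (fsuc i) = M (fsuc i)
  det-firstRowRepeated (suc n) (fsuc s) M M₀≈Mₛ = begin
    expandTwoRows n (M fzero) (M (fsuc fzero)) (lowerMinors M)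
      ≈⟨ sym (+-identityʳ _) ⟩
    expandTwoRows n (M fzero) (M (fsuc fzero)) (lowerMinors M) + 0#
      ≈⟨ +-congˡ (sym (expandRow-zero (M (fsuc fzero)) swappedMinorsVanish)) ⟩
    expandTwoRows n (M fzero) (M (fsuc fzero)) (lowerMinors M) + expandTwoRows n (M (fsuc fzero)) (M fzero) (lowerMinors M)
      ≈⟨ expandTwoRows-antisymmetric n (M fzero) (M (fsuc fzero)) (lowerMinors M) (lowerMinors-extensional M) ⟩
    0# ∎
    where
    swapped : Matrix (suc (suc n)) (suc (suc n))
    swapped fzero = M (fsuc fzero)
    swapped (fsuc fzero) = M fzero
    swapped (fsuc (fsuc i)) = M (fsuc (fsuc i))
    swappedMinorsVanish : ∀ j → det R (suc n) (minor swapped j) ≈ 0#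
    swappedMinorsVanish j = det-firstRowRepeated n s (minor swapped j) (λ k → M₀≈Mₛ (punchIn j k))

  det-alternating : ∀ n (M : Matrix n n) (i j : Fin n) → toℕ i ℕ.< toℕ j → (∀ k → M i k ≈ M j k) →
    det R n M ≈ 0#
  det-alternating (suc n) M fzero (fsuc s) _ Mᵢ≈Mⱼ = det-firstRowRepeated n s M Mᵢ≈Mⱼ
  det-alternating (suc n) M (fsuc i) (fsuc j) (s≤s i<j) Mᵢ≈Mⱼ =
    expandRow-zero (M fzero) (λ k → det-alternating n (minor M k) i j i<j (λ l → Mᵢ≈Mⱼ (punchIn k l)))

  infix 8 _[_]≔_
  _[_]≔_ : ∀ {n m} → Matrix n m → Fin n → (Fin m → A) → Matrix n m
  M [ i ]≔ v = updateAt M i (const v)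

  []≔-restrict : ∀ {n m m′} (M : Matrix n m) i v (f : Fin m′ → Fin m) i′ l →
    (M [ i ]≔ v) i′ (f l) ≡ ((λ r → M r ∘ f) [ i ]≔ (v ∘ f)) i′ l
  []≔-restrict M fzero v f fzero l = ≡.refl
  []≔-restrict M fzero v f (fsuc i′) l = ≡.refl
  []≔-restrict M (fsuc i) v f fzero l = ≡.refl
  []≔-restrict M (fsuc i) v f (fsuc i′) l = []≔-restrict (tail M) i v f i′ l

  det-firstRowCopied : ∀ n (M : Matrix (suc n) (suc n)) i → det R (suc n) (M [ fsuc i ]≔ M fzero) ≈ 0#
  det-firstRowCopied n M i = det-alternating (suc n) (M [ fsuc i ]≔ M fzero) fzero (fsuc i) (s≤s z≤n)
    (λ k → reflexive (≡.cong (λ r → r k) (≡.sym (updateAt-updates (fsuc i) M))))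

  det-rankOneUpdate : ∀ n (N : Matrix n n) (c v : Fin n → A) →
    det R n (λ i j → N i j + c i * v j) ≈ det R n N + ∑ n (λ i → c i * det R n (N [ i ]≔ v))
  det-rankOneUpdate zero N c v = sym (+-identityʳ 1#)
  det-rankOneUpdate (suc n) N c v = begin
    expandRow U (λ k → det R n (λ i l → N (fsuc i) (punchIn k l) + c (fsuc i) * v (punchIn k l)))
      ≈⟨ expandRow-cong U (λ k → det-rankOneUpdate n (minor N k) (tail c) (v ∘ punchIn k)) ⟩
    expandRow U (λ k → Δ k + ∑ n (λ i → tail c i * Δ′ i k))
      ≈⟨ expandRow-+∑ U Δ (tail c) Δ′ ⟩
    expandRow U Δ + ∑ n (λ i → tail c i * expandRow U (Δ′ i))
      ≈⟨ +-cong (expandRow-linear (N fzero) v (c fzero) Δ) (∑-cong n (λ i → *-congˡ (expandLowerRow i))) ⟩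
    (det R (suc n) N + c fzero * det R (suc n) (N [ fzero ]≔ v))
      + ∑ n (λ i → tail c i * det R (suc n) (N [ fsuc i ]≔ v))
      ≈⟨ +-assoc _ _ _ ⟩
    det R (suc n) N + ∑ (suc n) (λ i → c i * det R (suc n) (N [ i ]≔ v)) ∎
    where
    U Δ : Fin (suc n) → A
    U k = N fzero k + c fzero * v k
    Δ k = det R n (minor N k)
    Δ′ : Fin n → Fin (suc n) → A
    Δ′ i k = det R n (minor N k [ i ]≔ (v ∘ punchIn k))
    expandLowerRow : ∀ i → expandRow U (Δ′ i) ≈ det R (suc n) (N [ fsuc i ]≔ v)
    expandLowerRow i = begin
      expandRow U (Δ′ i)
        ≈⟨ expandRow-cong U (λ k → det-cong n (λ i′ l →
             reflexive (≡.sym ([]≔-restrict (tail N) i v (punchIn k) i′ l)))) ⟩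
      expandRow U (λ k → det R n (minor (N [ fsuc i ]≔ v) k))
        ≈⟨ expandRow-linear (N fzero) v (c fzero) (λ k → det R n (minor (N [ fsuc i ]≔ v) k)) ⟩
      det R (suc n) (N [ fsuc i ]≔ v) + c fzero * det R (suc n) ((N [ fzero ]≔ v) [ fsuc i ]≔ v)
        ≈⟨ +-congˡ (trans (*-congˡ (det-firstRowCopied n (N [ fzero ]≔ v) i)) (zeroʳ _)) ⟩
      det R (suc n) (N [ fsuc i ]≔ v) + 0#
        ≈⟨ +-identityʳ _ ⟩
      det R (suc n) (N [ fsuc i ]≔ v) ∎

  det-addMultiplesOfFirstRow : ∀ n (N : Matrix (suc n) (suc n)) (c : Fin n → A) →
    det R (suc n) (λ i j → N i j + (0# ∷ c) i * N fzero j) ≈ det R (suc n) N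
  det-addMultiplesOfFirstRow n N c =
    trans (det-rankOneUpdate (suc n) N (0# ∷ c) (N fzero)) (trans (+-congˡ (∑-zero (suc n) vanish)) (+-identityʳ _))
    where
    vanish : ∀ i → (0# ∷ c) i * det R (suc n) (N [ i ]≔ N fzero) ≈ 0#
    vanish fzero = zeroˡ _
    vanish (fsuc i) = trans (*-congˡ (det-firstRowCopied n N i)) (zeroʳ _)

  infixl 7 _∙_
  _∙_ : ∀ {m n p} → Matrix m n → Matrix n p → Matrix m p
  _∙_ {n = n} G V i j = ∑ n (λ k → G i k * V k j)

  det-unitLowerTriangular-∙ : ∀ n (G V : Matrix n n) →
    (∀ i → G i i ≈ 1#) → (∀ i k → toℕ i ℕ.< toℕ k → G i k ≈ 0#) → det R n (G ∙ V) ≈ det R n V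
  det-unitLowerTriangular-∙ zero G V diag upper = refl
  det-unitLowerTriangular-∙ (suc n) G V diag upper = begin
    det R (suc n) (G ∙ V)
      ≈⟨ det-cong (suc n) rows ⟩
    det R (suc n) (λ i j → W i j + (0# ∷ c) i * W fzero j)
      ≈⟨ det-addMultiplesOfFirstRow n W c ⟩
    expandRow (V fzero) (λ j → det R n (G′ ∙ minor V j))
      ≈⟨ expandRow-cong (V fzero) (λ j →
           det-unitLowerTriangular-∙ n G′ (minor V j) (diag ∘ fsuc) (λ i k i<k → upper _ _ (s≤s i<k))) ⟩
    det R (suc n) V ∎
    where
    G′ : Matrix n n
    G′ i k = G (fsuc i) (fsuc k)
    c : Fin n → A
    c i = G (fsuc i) fzero
    W : Matrix (suc n) (suc n)
    W = V fzero ∷ (G′ ∙ tail V)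
    rows : ∀ i j → (G ∙ V) i j ≈ W i j + (0# ∷ c) i * W fzero j
    rows fzero j = trans (+-cong (trans (*-congʳ (diag fzero)) (*-identityˡ _))
                                 (∑-zero n (λ k → trans (*-congʳ (upper fzero (fsuc k) (s≤s z≤n))) (zeroˡ _))))
                         (+-congˡ (sym (zeroˡ _)))
    rows (fsuc i) j = +-comm _ _

  expandRow-tailZero : ∀ {n} (u D : Fin (suc n) → A) → (∀ j → D (fsuc j) ≈ 0#) →
    expandRow u D ≈ u fzero * D fzero
  expandRow-tailZero {n} u D D≈0 =
    trans (+-cong (*-identityˡ _) (∑-zero n (λ j → trans (*-congˡ (trans (*-congˡ (D≈0 j)) (zeroʳ _))) (zeroʳ _))))
          (+-identityʳ _)

  mutual
    det-firstColumnZero : ∀ {n} (V : Matrix (suc n) (suc n)) → (∀ i → V i fzero ≈ 0#) → det R (suc n) V ≈ 0#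
    det-firstColumnZero V V₀≈0 =
      trans (expandRow-tailZero (V fzero) (λ j → det R _ (minor V j)) (minorsFirstColumnZero V (V₀≈0 ∘ fsuc)))
            (trans (*-congʳ (V₀≈0 fzero)) (zeroˡ _))

    minorsFirstColumnZero : ∀ {n} (V : Matrix (suc n) (suc n)) → (∀ i → V (fsuc i) fzero ≈ 0#) →
      ∀ j → det R n (minor V (fsuc j)) ≈ 0#
    minorsFirstColumnZero {suc n} V V₀≈0 j = det-firstColumnZero (minor V (fsuc j)) V₀≈0

  det-upperTriangular : ∀ n (V : Matrix n n) (d : ℕ → A) → (∀ i j → toℕ j ℕ.< toℕ i → V i j ≈ 0#) →
    (∀ i → V i i ≈ d (toℕ i)) → det R n V ≈ prodUpTo R d n
  det-upperTriangular zero V d lower diag = refl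
  det-upperTriangular (suc n) V d lower diag = begin
    det R (suc n) V
      ≈⟨ expandRow-tailZero (V fzero) (λ j → det R _ (minor V j))
           (minorsFirstColumnZero V (λ i → lower (fsuc i) fzero (s≤s z≤n))) ⟩
    V fzero fzero * det R n (minor V fzero)
      ≈⟨ *-cong (diag fzero)
           (det-upperTriangular n (minor V fzero) (d ∘ suc) (λ i j j<i → lower _ _ (s≤s j<i)) (diag ∘ fsuc)) ⟩
    d 0 * prodUpTo R (d ∘ suc) n
      ≈⟨ sym (prodUpTo-head n d) ⟩
    prodUpTo R d (suc n) ∎

module MotzkinPaths {a ℓ : Level} (R : CommutativeRing a ℓ) (b l : ℕ → CommutativeRing.Carrier R) where
  open CommutativeRing R renaming (Carrier to A)
  open IntegerRingSolver R
  open Determinant R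
  open import Relation.Binary.Reasoning.Setoid setoid

  shiftRight : (ℕ → A) → ℕ → A
  shiftRight f zero = 0#
  shiftRight f (suc k) = f k

  -- Weighted Motzkin paths: an up step has weight 1, a level step at height h weight b h,
  -- and a down step from height h + 1 weight l h.
  pathsFrom0 : ℕ → ℕ → A
  pathsFrom0 zero zero = 1#
  pathsFrom0 zero (suc k) = 0#
  pathsFrom0 (suc n) k = shiftRight (pathsFrom0 n) k + b k * pathsFrom0 n k + l k * pathsFrom0 n (suc k)

  pathsTo0 : ℕ → ℕ → A
  pathsTo0 zero zero = 1#
  pathsTo0 zero (suc m) = 0#
  pathsTo0 (suc n) m = pathsTo0 n (suc m) + b m * pathsTo0 n m + shiftRight (λ k → l k * pathsTo0 n k) m

  private
    x+u*y+v*z≈x : ∀ {x y z u v : A} → y ≈ 0# → z ≈ 0# → x + u * y + v * z ≈ x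
    x+u*y+v*z≈x y≈0 z≈0 =
      trans (+-cong (+-congˡ (trans (*-congˡ y≈0) (zeroʳ _))) (trans (*-congˡ z≈0) (zeroʳ _)))
            (trans (+-identityʳ _) (+-identityʳ _))

  pathsFrom0-vanish : ∀ n k → n ℕ.< k → pathsFrom0 n k ≈ 0#
  pathsFrom0-vanish zero (suc k) _ = refl
  pathsFrom0-vanish (suc n) (suc k) (s≤s n<k) = trans
    (x+u*y+v*z≈x (pathsFrom0-vanish n (suc k) (ℕ.m<n⇒m<1+n n<k))
                 (pathsFrom0-vanish n (suc (suc k)) (ℕ.m<n⇒m<1+n (ℕ.m<n⇒m<1+n n<k))))
    (pathsFrom0-vanish n k n<k)

  pathsTo0-vanish : ∀ n m → n ℕ.< m → pathsTo0 n m ≈ 0#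
  pathsTo0-vanish zero (suc m) _ = refl
  pathsTo0-vanish (suc n) (suc m) (s≤s n<m) = trans
    (x+u*y+v*z≈x (pathsTo0-vanish n (suc m) (ℕ.m<n⇒m<1+n n<m)) (pathsTo0-vanish n m n<m))
    (pathsTo0-vanish n (suc (suc m)) (ℕ.m<n⇒m<1+n (ℕ.m<n⇒m<1+n n<m)))

  pathsFrom0-diagonal : ∀ n → pathsFrom0 n n ≈ 1#
  pathsFrom0-diagonal zero = refl
  pathsFrom0-diagonal (suc n) = trans
    (x+u*y+v*z≈x (pathsFrom0-vanish n (suc n) (ℕ.n<1+n n))
                 (pathsFrom0-vanish n (suc (suc n)) (ℕ.m<n⇒m<1+n (ℕ.n<1+n n))))
    (pathsFrom0-diagonal n)

  pathsTo0-diagonal : ∀ n → pathsTo0 n n ≈ prodUpTo R l n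
  pathsTo0-diagonal zero = refl
  pathsTo0-diagonal (suc n) =
    trans (+-cong (+-cong (pathsTo0-vanish n (suc (suc n)) (ℕ.m<n⇒m<1+n (ℕ.n<1+n n)))
                          (trans (*-congˡ (pathsTo0-vanish n (suc n) (ℕ.n<1+n n))) (zeroʳ _)))
                  (*-congˡ (pathsTo0-diagonal n)))
          (trans (trans (+-congʳ (+-identityʳ _)) (+-identityˡ _)) (*-comm _ _))

  sumTo : ℕ → (ℕ → A) → A
  sumTo N f = ∑ N (λ k → f (toℕ k))

  sumTo-cong : ∀ N {f g : ℕ → A} → (∀ k → f k ≈ g k) → sumTo N f ≈ sumTo N g
  sumTo-cong N f≈g = ∑-cong N (λ k → f≈g (toℕ k))

  sumTo-+₃ : ∀ N (f g h : ℕ → A) → sumTo N (λ k → f k + g k + h k) ≈ sumTo N f + sumTo N g + sumTo N h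
  sumTo-+₃ N f g h = trans (∑-distrib-+ N _ _) (+-congʳ (∑-distrib-+ N _ _))

  sumTo-last : ∀ N (f : ℕ → A) → sumTo (suc N) f ≈ sumTo N f + f N
  sumTo-last zero f = trans (+-identityʳ _) (sym (+-identityˡ _))
  sumTo-last (suc N) f = trans (+-congˡ (sumTo-last N (f ∘ suc))) (sym (+-assoc _ _ _))

  sumTo-shiftRight : ∀ N (f : ℕ → A) → f N ≈ 0# → sumTo (suc N) (shiftRight f) ≈ sumTo (suc N) f
  sumTo-shiftRight N f fN≈0 = begin
    0# + sumTo N f     ≈⟨ +-identityˡ _ ⟩
    sumTo N f          ≈⟨ sym (+-identityʳ _) ⟩
    sumTo N f + 0#     ≈⟨ +-congˡ (sym fN≈0) ⟩
    sumTo N f + f N    ≈⟨ sym (sumTo-last N f) ⟩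
    sumTo (suc N) f    ∎

  -- Moving one step of the path from its end to its start.
  sumTo-moveStep : ∀ i j N → i ℕ.< N →
    sumTo (suc N) (λ k → pathsFrom0 (suc i) k * pathsTo0 j k)
      ≈ sumTo (suc N) (λ k → pathsFrom0 i k * pathsTo0 (suc j) k)
  sumTo-moveStep i j N i<N = begin
    sumTo (suc N) (λ k → pathsFrom0 (suc i) k * H k)
      ≈⟨ sumTo-cong (suc N) distribFrom ⟩
    sumTo (suc N) (λ k → shiftRight up k + level k + down k)
      ≈⟨ sumTo-+₃ (suc N) (shiftRight up) level down ⟩
    sumTo (suc N) (shiftRight up) + sumTo (suc N) level + sumTo (suc N) down
      ≈⟨ +-cong (+-congʳ (sumTo-shiftRight N up upLast)) (sym (sumTo-shiftRight N down downLast)) ⟩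
    sumTo (suc N) up + sumTo (suc N) level + sumTo (suc N) (shiftRight down)
      ≈⟨ sym (sumTo-+₃ (suc N) up level (shiftRight down)) ⟩
    sumTo (suc N) (λ k → up k + level k + shiftRight down k)
      ≈⟨ sumTo-cong (suc N) distribTo ⟩
    sumTo (suc N) (λ k → G k * pathsTo0 (suc j) k) ∎
    where
    G H up level down : ℕ → A
    G = pathsFrom0 i
    H = pathsTo0 j
    up k = G k * H (suc k)
    level k = b k * G k * H k
    down k = l k * G (suc k) * H k
    upLast : up N ≈ 0#
    upLast = trans (*-congʳ (pathsFrom0-vanish i N i<N)) (zeroˡ _)
    downLast : down N ≈ 0#
    downLast = trans (*-congʳ (trans (*-congˡ (pathsFrom0-vanish i (suc N) (ℕ.m<n⇒m<1+n i<N))) (zeroʳ _))) (zeroˡ _)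
    distribFrom : ∀ k → pathsFrom0 (suc i) k * H k ≈ shiftRight up k + level k + down k
    distribFrom zero = solve 5 (λ b₀ G₀ l₀ G₁ H₀ →
      (:0 :+ b₀ :* G₀ :+ l₀ :* G₁) :* H₀ ⊜ :0 :+ b₀ :* G₀ :* H₀ :+ l₀ :* G₁ :* H₀) refl _ _ _ _ _
    distribFrom (suc k) = solve 6 (λ Gₖ b G l G′ H →
      (Gₖ :+ b :* G :+ l :* G′) :* H ⊜ Gₖ :* H :+ b :* G :* H :+ l :* G′ :* H) refl _ _ _ _ _ _
    distribTo : ∀ k → up k + level k + shiftRight down k ≈ G k * pathsTo0 (suc j) k
    distribTo zero = solve 4 (λ G₀ H₁ b₀ H₀ →
      G₀ :* H₁ :+ b₀ :* G₀ :* H₀ :+ :0 ⊜ G₀ :* (H₁ :+ b₀ :* H₀ :+ :0)) refl _ _ _ _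
    distribTo (suc k) = solve 6 (λ G H′ b H l Hₖ →
      G :* H′ :+ b :* G :* H :+ l :* G :* Hₖ ⊜ G :* (H′ :+ b :* H :+ l :* Hₖ)) refl _ _ _ _ _ _

  pathsTo0-concatenate : ∀ i j N → i ℕ.< N →
    sumTo N (λ k → pathsFrom0 i k * pathsTo0 j k) ≈ pathsTo0 (i ℕ.+ j) 0
  pathsTo0-concatenate zero j (suc N) _ =
    trans (+-cong (*-identityˡ _) (∑-zero N (λ k → zeroˡ _))) (+-identityʳ _)
  pathsTo0-concatenate (suc i) j (suc N) (s≤s i<N) = begin
    sumTo (suc N) (λ k → pathsFrom0 (suc i) k * pathsTo0 j k)
      ≈⟨ sumTo-moveStep i j N i<N ⟩
    sumTo (suc N) (λ k → pathsFrom0 i k * pathsTo0 (suc j) k)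
      ≈⟨ pathsTo0-concatenate i (suc j) (suc N) (ℕ.m<n⇒m<1+n i<N) ⟩
    pathsTo0 (i ℕ.+ suc j) 0
      ≡⟨ ≡.cong (λ t → pathsTo0 t 0) (ℕ.+-suc i j) ⟩
    pathsTo0 (suc i ℕ.+ j) 0 ∎

  hankel-pathsTo0 : ∀ n → det R n (λ i j → pathsTo0 (toℕ i ℕ.+ toℕ j) 0) ≈ prodUpTo R (prodUpTo R l) n
  hankel-pathsTo0 n = begin
    det R n (λ i j → pathsTo0 (toℕ i ℕ.+ toℕ j) 0)
      ≈⟨ det-cong n (λ i j → sym (pathsTo0-concatenate (toℕ i) (toℕ j) n (toℕ<n i))) ⟩
    det R n (G ∙ V)
      ≈⟨ det-unitLowerTriangular-∙ n G V (λ i → pathsFrom0-diagonal (toℕ i))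
                                         (λ i k → pathsFrom0-vanish (toℕ i) (toℕ k)) ⟩
    det R n V
      ≈⟨ det-upperTriangular n V (prodUpTo R l) (λ k j → pathsTo0-vanish (toℕ j) (toℕ k))
                                                (λ k → pathsTo0-diagonal (toℕ k)) ⟩
    prodUpTo R (prodUpTo R l) n ∎
    where
    G V : Matrix n n
    G i k = pathsFrom0 (toℕ i) (toℕ k)
    V k j = pathsTo0 (toℕ j) (toℕ k)

module PsiMoments {a ℓ : Level} (R : CommutativeRing a ℓ) (q x : CommutativeRing.Carrier R) (c : ℕ) where
  open import Data.List.Base using ([]; _∷_)
  open import Data.Nat.GeneralisedArithmetic using (fold; iterate; iterate-is-fold)
  open CommutativeRing R renaming (Carrier to A)
  open IntegerRingSolver R
  open QArithmetic R
  open import Relation.Binary.Reasoning.Setoid setoid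

  -- A linear functional on polynomials in X, given by its values on the monomials.
  Functional : Set a
  Functional = ℕ → A

  pair : Functional → Poly R → A
  pair w [] = 0#
  pair w (u ∷ us) = u * w 0 + pair (w ∘ suc) us

  pair-cong : ∀ {w w′ : Functional} → (∀ k → w k ≈ w′ k) → ∀ p → pair w p ≈ pair w′ p
  pair-cong w≈w′ [] = refl
  pair-cong w≈w′ (u ∷ us) = +-cong (*-congˡ (w≈w′ 0)) (pair-cong (w≈w′ ∘ suc) us)

  pair-+ : ∀ (w w′ : Functional) p → pair (λ k → w k + w′ k) p ≈ pair w p + pair w′ p
  pair-+ w w′ [] = sym (+-identityʳ _)
  pair-+ w w′ (u ∷ us) = trans (+-congˡ (pair-+ (w ∘ suc) (w′ ∘ suc) us))
    (solve 5 (λ u a b c d → u :* (a :+ b) :+ (c :+ d) ⊜ (u :* a :+ c) :+ (u :* b :+ d)) refl _ _ _ _ _)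

  pair-* : ∀ α (w : Functional) p → pair (λ k → α * w k) p ≈ α * pair w p
  pair-* α w [] = sym (zeroʳ _)
  pair-* α w (u ∷ us) = trans (+-congˡ (pair-* α (w ∘ suc) us))
    (solve 4 (λ u α a c → u :* (α :* a) :+ α :* c ⊜ α :* (u :* a :+ c)) refl _ _ _ _)

  pair-⊕ : ∀ w p p′ → pair w (_⊕_ R p p′) ≈ pair w p + pair w p′
  pair-⊕ w [] p′ = sym (+-identityˡ _)
  pair-⊕ w (u ∷ us) [] = sym (+-identityʳ _)
  pair-⊕ w (u ∷ us) (v ∷ vs) = trans (+-congˡ (pair-⊕ (w ∘ suc) us vs))
    (solve 5 (λ u v a b c → (u :+ v) :* a :+ (b :+ c) ⊜ (u :* a :+ b) :+ (v :* a :+ c)) refl _ _ _ _ _)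

  pair-mulXPow : ∀ k w p → pair w (mulXPow R k p) ≈ pair (λ i → w (k ℕ.+ i)) p
  pair-mulXPow zero w p = refl
  pair-mulXPow (suc k) w p = trans (+-congˡ (pair-mulXPow k (w ∘ suc) p)) (trans (+-congʳ (zeroˡ _)) (+-identityˡ _))

  pair-DFrom : ∀ k w p → pair w (DFrom R q k p) ≈ pair (λ i → qint R q (k ℕ.+ i) * w i) p
  pair-DFrom k w [] = refl
  pair-DFrom k w (u ∷ us) = +-cong
    (trans (*-assoc _ _ _) (*-congˡ (*-congʳ (reflexive (≡.cong (qint R q) (≡.sym (ℕ.+-identityʳ k)))))))
    (trans (pair-DFrom (suc k) (w ∘ suc) us)
           (pair-cong (λ i → *-congʳ (reflexive (≡.cong (qint R q) (≡.sym (ℕ.+-suc k i))))) us))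

  -- The transposes of multiplication by X^c and of X D.
  mulXᶜᵗ xDᵗ Tᵗ : Functional → Functional
  mulXᶜᵗ w k = w (c ℕ.+ k)
  xDᵗ w k = qint R q k * w k
  Tᵗ w k = mulXᶜᵗ w k + xDᵗ w k

  pair-xD : ∀ w p → pair w (mulXPow R 1 (D R q p)) ≈ pair (xDᵗ w) p
  pair-xD w [] = trans (+-identityʳ _) (zeroˡ _)
  pair-xD w (u ∷ us) =
    +-cong (trans (zeroˡ _) (sym (trans (*-congˡ (zeroˡ _)) (zeroʳ _)))) (pair-DFrom 1 (w ∘ suc) us)

  pair-T : ∀ w p → pair w (T R q c p) ≈ pair (Tᵗ w) p
  pair-T w p = begin
    pair w (T R q c p)                                    ≈⟨ pair-⊕ w (mulXPow R c p) (mulXPow R 1 (D R q p)) ⟩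
    pair w (mulXPow R c p) + pair w (mulXPow R 1 (D R q p)) ≈⟨ +-cong (pair-mulXPow c w p) (pair-xD w p) ⟩
    pair (mulXᶜᵗ w) p + pair (xDᵗ w) p                   ≈⟨ sym (pair-+ (mulXᶜᵗ w) (xDᵗ w) p) ⟩
    pair (Tᵗ w) p                                         ∎

  pair-ψ : ∀ n w → pair w (ψ R q c n) ≈ iterate Tᵗ w n 0
  pair-ψ zero w = trans (+-identityʳ _) (*-identityˡ _)
  pair-ψ (suc n) w = trans (pair-T w (ψ R q c n)) (pair-ψ n (Tᵗ w))

  eval-pair : ∀ p → eval R x p ≈ pair (pow R x) p
  eval-pair [] = refl
  eval-pair (u ∷ us) = +-cong (sym (*-identityʳ _)) (trans (*-congˡ (eval-pair us)) (sym (pair-* x (pow R x) us)))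

  eval-ψ : ∀ n → eval R x (ψ R q c n) ≈ fold (pow R x) Tᵗ n 0
  eval-ψ n = trans (eval-pair (ψ R q c n)) (trans (pair-ψ n (pow R x))
    (reflexive (≡.cong (λ w → w 0) (≡.sym (iterate-is-fold (pow R x) Tᵗ n)))))

  y p [c] : A
  y = pow R x c
  p = pow R q c
  [c] = qint R q c

  levelWeight downWeight : ℕ → A
  levelWeight m = y * pow R p m + [c] * qint R p m
  downWeight m = [c] * qint R p (suc m) * (y * pow R p m)

  open MotzkinPaths R levelWeight downWeight

  -- Φ m w is the value of w on P_m = (X^c − y)(X^c − y p)⋯(X^c − y p^(m−1)).
  Φ : ℕ → Functional → A
  Φ zero w = w 0
  Φ (suc m) w = Φ m (mulXᶜᵗ w) - y * pow R p m * Φ m w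

  Φ-cong : ∀ m {w w′ : Functional} → (∀ k → w k ≈ w′ k) → Φ m w ≈ Φ m w′
  Φ-cong zero w≈w′ = w≈w′ 0
  Φ-cong (suc m) w≈w′ = +-cong (Φ-cong m (λ k → w≈w′ (c ℕ.+ k))) (-‿cong (*-congˡ (Φ-cong m w≈w′)))

  Φ-+ : ∀ m (w w′ : Functional) → Φ m (λ k → w k + w′ k) ≈ Φ m w + Φ m w′
  Φ-+ zero w w′ = refl
  Φ-+ (suc m) w w′ = trans (+-cong (Φ-+ m (mulXᶜᵗ w) (mulXᶜᵗ w′)) (-‿cong (*-congˡ (Φ-+ m w w′))))
    (solve 5 (λ a b c d z → (a :+ b) :+ :- (z :* (c :+ d)) ⊜ (a :+ :- (z :* c)) :+ (b :+ :- (z :* d))) refl _ _ _ _ _)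

  Φ-* : ∀ m α (w : Functional) → Φ m (λ k → α * w k) ≈ α * Φ m w
  Φ-* zero α w = refl
  Φ-* (suc m) α w = trans (+-cong (Φ-* m α (mulXᶜᵗ w)) (-‿cong (*-congˡ (Φ-* m α w))))
    (solve 4 (λ α a b z → α :* a :+ :- (z :* (α :* b)) ⊜ α :* (a :+ :- (z :* b))) refl _ _ _ _)

  Φ-mulXᶜᵗ-xDᵗ : ∀ m w → Φ m (mulXᶜᵗ (xDᵗ w)) ≈ [c] * Φ m (mulXᶜᵗ w) + p * Φ m (xDᵗ (mulXᶜᵗ w))
  Φ-mulXᶜᵗ-xDᵗ m w = begin
    Φ m (mulXᶜᵗ (xDᵗ w))
      ≈⟨ Φ-cong m (λ k → trans (*-congʳ (qint-+ q c k))
           (solve 4 (λ a p Q W → (a :+ p :* Q) :* W ⊜ a :* W :+ p :* (Q :* W)) refl _ _ _ _)) ⟩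
    Φ m (λ k → [c] * mulXᶜᵗ w k + p * xDᵗ (mulXᶜᵗ w) k)
      ≈⟨ Φ-+ m _ _ ⟩
    Φ m (λ k → [c] * mulXᶜᵗ w k) + Φ m (λ k → p * xDᵗ (mulXᶜᵗ w) k)
      ≈⟨ +-cong (Φ-* m [c] (mulXᶜᵗ w)) (Φ-* m p (xDᵗ (mulXᶜᵗ w))) ⟩
    [c] * Φ m (mulXᶜᵗ w) + p * Φ m (xDᵗ (mulXᶜᵗ w)) ∎

  Φ-xDᵗ : ∀ m w → Φ (suc m) (xDᵗ w) ≈ [c] * qint R p (suc m) * Φ m (mulXᶜᵗ w)
  Φ-xDᵗ zero w = trans (+-congʳ (Φ-mulXᶜᵗ-xDᵗ 0 w))
    (solve 5 (λ a p y W w₀ → (a :* W :+ p :* (:0 :* W)) :+ :- (y :* :1 :* (:0 :* w₀)) ⊜ a :* (:1 :+ p :* :0) :* W)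
             refl _ _ _ _ _)
  Φ-xDᵗ (suc m) w =
    trans (+-cong (trans (Φ-mulXᶜᵗ-xDᵗ (suc m) w) (+-congˡ (*-congˡ (Φ-xDᵗ m (mulXᶜᵗ w)))))
                  (-‿cong (*-congˡ (Φ-xDᵗ m w))))
    (solve 7 (λ a p y P Q S T → (a :* (S :+ :- (y :* P :* T)) :+ p :* (a :* Q :* S)) :+ :- (y :* (p :* P) :* (a :* Q :* T))
                              ⊜ a :* (:1 :+ p :* Q) :* (S :+ :- (y :* P :* T))) refl _ _ _ _ _ _ _)

  Φ-Tᵗ : ∀ m w → Φ m (Tᵗ w) ≈ Φ (suc m) w + levelWeight m * Φ m w + shiftRight (λ k → downWeight k * Φ k w) m
  Φ-Tᵗ zero w = solve 4 (λ W w₀ y a → W :+ :0 :* w₀ ⊜ (W :+ :- (y :* :1 :* w₀)) :+ (y :* :1 :+ a :* :0) :* w₀ :+ :0)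
                        refl _ _ _ _
  Φ-Tᵗ (suc m) w = trans (Φ-+ (suc m) (mulXᶜᵗ w) (xDᵗ w)) (trans (+-congˡ (Φ-xDᵗ m w))
    (solve 8 (λ U Z V y P p a Q → U :+ a :* Q :* Z ⊜
       (U :+ :- (y :* (p :* P) :* (Z :+ :- (y :* P :* V)))) :+ (y :* (p :* P) :+ a :* Q) :* (Z :+ :- (y :* P :* V))
         :+ a :* Q :* (y :* P) :* V)
      refl _ _ _ _ _ _ _ _))

  -- Evaluation at x annihilates the factor X^c − y.
  Φ-eval : ∀ m → Φ (suc m) (pow R x) ≈ 0#
  Φ-eval zero = trans (+-congʳ (pow-+ x c 0)) (solve 1 (λ y → y :* :1 :+ :- (y :* :1 :* :1) ⊜ :0) refl _)
  Φ-eval (suc m) =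
    trans (+-cong (trans (Φ-cong (suc m) (pow-+ x c)) (trans (Φ-* (suc m) y (pow R x)) (*-congˡ (Φ-eval m))))
                  (-‿cong (*-congˡ (Φ-eval m))))
    (solve 2 (λ y z → y :* :0 :+ :- (z :* :0) ⊜ :0) refl _ _)

  Φ-moments : ∀ n m → Φ m (fold (pow R x) Tᵗ n) ≈ pathsTo0 n m
  Φ-moments zero zero = refl
  Φ-moments zero (suc m) = Φ-eval m
  Φ-moments (suc n) m = trans (Φ-Tᵗ m (fold (pow R x) Tᵗ n))
    (+-cong (+-cong (Φ-moments n (suc m)) (*-congˡ (Φ-moments n m))) (shiftRight-down m))
    where
    shiftRight-down : ∀ m → shiftRight (λ k → downWeight k * Φ k (fold (pow R x) Tᵗ n)) m
                          ≈ shiftRight (λ k → downWeight k * pathsTo0 n k) m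
    shiftRight-down zero = refl
    shiftRight-down (suc m) = *-congˡ (Φ-moments n m)

  eval-ψ-moments : ∀ n → eval R x (ψ R q c n) ≈ pathsTo0 n 0
  eval-ψ-moments n = trans (eval-ψ n) (Φ-moments n 0)

  prodUpTo-downWeight : ∀ n → prodUpTo R downWeight n ≈ ((pow R [c] n * pow R y n) * pow R p (n C 2)) * qfact R p n
  prodUpTo-downWeight zero = solve 0 (:1 ⊜ ((:1 :* :1) :* :1) :* :1) refl
  prodUpTo-downWeight (suc n) = begin
    prodUpTo R downWeight n * downWeight n
      ≈⟨ *-congʳ (prodUpTo-downWeight n) ⟩
    (((pow R [c] n * pow R y n) * pow R p (n C 2)) * qfact R p n) * ([c] * qint R p (suc n) * (y * pow R p n))
      ≈⟨ solve 8 (λ a An y Yn Pn PC F Q → (((An :* Yn) :* PC) :* F) :* (a :* Q :* (y :* Pn))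
                                        ⊜ (((a :* An) :* (y :* Yn)) :* (Pn :* PC)) :* (F :* Q)) refl _ _ _ _ _ _ _ _ ⟩
    ((pow R [c] (suc n) * pow R y (suc n)) * (pow R p n * pow R p (n C 2))) * qfact R p (suc n)
      ≈⟨ *-congʳ (*-congˡ p-powers) ⟩
    ((pow R [c] (suc n) * pow R y (suc n)) * pow R p (suc n C 2)) * qfact R p (suc n) ∎
    where
    p-powers : pow R p n * pow R p (n C 2) ≈ pow R p (suc n C 2)
    p-powers = trans (sym (pow-+ p n (n C 2))) (reflexive (≡.cong (pow R p) (≡.sym ([1+n]C2≡n+nC2 n))))

  hankelValue : ℕ → A
  hankelValue n = ((pow R [c] (n C 2) * pow R x (c ℕ.* (n C 2))) * pow R q (c ℕ.* (n C 3))) * prodUpTo R (qfact R p) n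

  prodUpTo-prodUpTo-downWeight : ∀ n → prodUpTo R (prodUpTo R downWeight) n ≈ hankelValue n
  prodUpTo-prodUpTo-downWeight zero rewrite ℕ.*-zeroʳ c = solve 0 (:1 ⊜ ((:1 :* :1) :* :1) :* :1) refl
  prodUpTo-prodUpTo-downWeight (suc n) = begin
    prodUpTo R (prodUpTo R downWeight) n * prodUpTo R downWeight n
      ≈⟨ *-cong (prodUpTo-prodUpTo-downWeight n) (prodUpTo-downWeight n) ⟩
    hankelValue n * (((pow R [c] n * pow R y n) * pow R p (n C 2)) * qfact R p n)
      ≈⟨ solve 8 (λ An AC Yn XC PC QC Pr F → (((AC :* XC) :* QC) :* Pr) :* (((An :* Yn) :* PC) :* F)
                                           ⊜ (((An :* AC) :* (Yn :* XC)) :* (PC :* QC)) :* (Pr :* F)) refl _ _ _ _ _ _ _ _ ⟩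
    (((pow R [c] n * pow R [c] (n C 2)) * (pow R y n * pow R x (c ℕ.* (n C 2)))) * (pow R p (n C 2) * pow R q (c ℕ.* (n C 3))))
      * prodUpTo R (qfact R p) (suc n)
      ≈⟨ *-congʳ (*-cong (*-cong [c]-powers x-powers) q-powers) ⟩
    hankelValue (suc n) ∎
    where
    [c]-powers : pow R [c] n * pow R [c] (n C 2) ≈ pow R [c] (suc n C 2)
    [c]-powers = trans (sym (pow-+ [c] n (n C 2))) (reflexive (≡.cong (pow R [c]) (≡.sym ([1+n]C2≡n+nC2 n))))
    x-powers : pow R y n * pow R x (c ℕ.* (n C 2)) ≈ pow R x (c ℕ.* (suc n C 2))
    x-powers = trans (pow-pow-+ x c n (n C 2))
                     (reflexive (≡.cong (λ t → pow R x (c ℕ.* t)) (≡.sym ([1+n]C2≡n+nC2 n))))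
    q-powers : pow R p (n C 2) * pow R q (c ℕ.* (n C 3)) ≈ pow R q (c ℕ.* (suc n C 3))
    q-powers = trans (pow-pow-+ q c (n C 2) (n C 3))
                     (reflexive (≡.cong (λ t → pow R q (c ℕ.* t)) (≡.sym ([1+n]C3≡nC2+nC3 n))))

mainTheorem4 : ∀ {a ℓ} (R : CommutativeRing a ℓ) (q x : CommutativeRing.Carrier R) (c : ℕ) → 1 ℕ.≤ c →
  (n : ℕ) → 1 ℕ.≤ n →
    CommutativeRing._≈_ R
      (det R n (λ i j → eval R x (ψ R q c (toℕ i ℕ.+ toℕ j))))
      (CommutativeRing._*_ R
        (CommutativeRing._*_ R
          (CommutativeRing._*_ R (pow R (qint R q c) (n C 2)) (pow R x (c ℕ.* (n C 2))))
          (pow R q (c ℕ.* (n C 3))))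
        (prodUpTo R (λ j → qfact R (pow R q c) j) n))
mainTheorem4 R q x c _ n _ = begin
  det R n (λ i j → eval R x (ψ R q c (toℕ i ℕ.+ toℕ j)))  ≈⟨ det-cong n (λ i j → eval-ψ-moments (toℕ i ℕ.+ toℕ j)) ⟩
  det R n (λ i j → pathsTo0 (toℕ i ℕ.+ toℕ j) 0)            ≈⟨ hankel-pathsTo0 n ⟩
  prodUpTo R (prodUpTo R downWeight) n                       ≈⟨ prodUpTo-prodUpTo-downWeight n ⟩
  hankelValue n                                              ∎
  where
  open CommutativeRing R using (setoid)
  open import Relation.Binary.Reasoning.Setoid setoid
  open Determinant R using (det-cong)
  open PsiMoments R q x c
  open MotzkinPaths R levelWeight downWeight using (pathsTo0; hankel-pathsTo0)
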